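{- Let $\mathcal{B}\subseteq\mathcal{P}$ be maximal intersecting with respect to $\mathcal{P}$, and let $\mathcal{D}\subseteq\mathcal{U}$. Then the following are equivalent: (i) $(\mathcal{U}\setminus\mathcal{D})\cup\mathcal{D}^c$ is maximal intersecting with respect to $\mathcal{P}$; (ii) (a) $\mathcal{D}$ is a $\mathcal{U}$-down-set, i.e., if $D\in\mathcal{D}$ and $D\supseteq D'\in\mathcal{U}$ then $D'\in\mathcal{D}$; and (b) if $D_1,D_2\in\mathcal{D}$ then $D_1\cup D_2\neq[n]$.
   Context: Let $n\in\mathbb{N}^+$, $[n]=\{1,\dots,n\}$, and $\mathcal{P}$ the family of nonempty proper subsets of $[n]$. For $B\in\mathcal{P}$, $B^c=[n]\setminus B$; for $\mathcal{D}\subseteq\mathcal{P}$, $\mathcal{D}^c=\{D^c:D\in\mathcal{D}\}$. $\mathcal{U}=\{B\in\mathcal{P}:1\in B\}$. A family $\mathcal{B}\subseteq\mathcal{P}$ is intersecting if $B_1\cap B_2\neq\emptyset$ for all $B_1,B_2\in\mathcal{B}$, and maximal intersecting with respect to $\mathcal{P}$ if it is intersecting and for every $Y\in\mathcal{P}\setminus\mathcal{B}$ there is $B\in\mathcal{B}$ with $B\cap Y=\emptyset$. -}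

module Defs where

open import Data.Bool using (Bool; T)
open import Data.Nat using (ℕ; suc)
open import Data.Fin using (Fin; zero)
open import Data.Fin.Subset using (Subset; _∈_; _⊆_; ∁; _∩_; _∪_; ⊤; Nonempty; Empty)
open import Data.Product using (_×_; ∃-syntax)
open import Data.Sum using (_⊎_)
open import Relation.Nullary using (¬_)
open import Relation.Binary.PropositionalEquality using (_≡_; _≢_)

-- Ground set [n] is Fin n; the element "1" of the paper is Fin.zero,
-- so we work with Fin (suc n) (n ∈ ℕ⁺).

Family : ℕ → Set
Family n = Subset n → Bool

SFam : ℕ → Set₁
SFam n = Subset n → Set

mem : ∀ {n} → Family n → SFam n
mem 𝒟 X = T (𝒟 X)

InP : ∀ {n} → SFam n
InP X = Nonempty X × X ≢ ⊤

InU : ∀ {n} → SFam (suc n)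
InU X = InP X × zero ∈ X

_⊆F_ : ∀ {n} → SFam n → SFam n → Set
F ⊆F G = ∀ X → F X → G X

Intersecting : ∀ {n} → SFam n → Set
Intersecting F = ∀ A B → F A → F B → Nonempty (A ∩ B)

MaximalIntersecting : ∀ {n} → SFam n → Set
MaximalIntersecting F =
  (F ⊆F InP) × Intersecting F ×
  (∀ Y → InP Y → ¬ F Y → ∃[ B ] (F B × Empty (B ∩ Y)))

complF : ∀ {n} → SFam n → SFam n
complF F X = ∃[ D ] (F D × X ≡ ∁ D)

switch : ∀ {n} → SFam (suc n) → SFam (suc n)
switch 𝒟 X = (InU X × ¬ 𝒟 X) ⊎ complF 𝒟 X

UDownSet : ∀ {n} → SFam (suc n) → Set
UDownSet 𝒟 = ∀ D D′ → 𝒟 D → D′ ⊆ D → InU D′ → 𝒟 D′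

NonCovering : ∀ {n} → SFam n → Set
NonCovering 𝒟 = ∀ D₁ D₂ → 𝒟 D₁ → 𝒟 D₂ → D₁ ∪ D₂ ≢ ⊤

-- Write 𝒮 = (𝒰 ∖ 𝒟) ∪ 𝒟ᶜ. Maximality of 𝒮 holds for every 𝒟: a set Y ∈ 𝒫
-- outside 𝒮 either contains 1, and then Y ∈ 𝒟 and Yᶜ ∈ 𝒮, or misses 1, and
-- then Yᶜ ∈ 𝒰 ∖ 𝒟; in both cases Yᶜ ∈ 𝒮 is disjoint from Y. So only
-- intersection matters. Two members of 𝒰 ∖ 𝒟 share 1; D₁ᶜ and D₂ᶜ meet iff
-- D₁ ∪ D₂ ≠ [n]; and A ∈ 𝒰 ∖ 𝒟 meets Dᶜ iff A ⊈ D, which for all such A and D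
-- says exactly that 𝒟 is a 𝒰-down-set.
module Submission where

open import Defs
open import Data.Nat using (ℕ; suc)
open import Data.Product using (_×_; _,_; proj₁; ∃-syntax)
open import Data.Sum using (inj₁; inj₂)
open import Data.Fin using (zero)
open import Data.Fin.Subset using (Subset; _∈_; _⊆_; ∁; _∩_; _∪_; ⊤; ⊥; Nonempty; Empty)
open import Data.Fin.Subset.Properties
  using (∪-∩-booleanAlgebra; ∩-comm; ∩-inverseˡ; Empty-unique; nonempty?; ∉⊥;
         x∈p∩q⁺; x∈p∩q⁻; x∈∁p⇒x∉p; x∉∁p⇒x∈p; x∉p⇒x∈∁p; _∈?_)
open import Algebra.Lattice.Properties.BooleanAlgebra as BooleanAlgebraProperties
  using ()
open import Function.Bundles using (_⇔_; mk⇔; Equivalence)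
open import Function.Properties.Equivalence using () renaming (trans to ⇔-trans)
open import Relation.Nullary using (¬_; yes; no; contradiction)
open import Relation.Nullary.Decidable using (T?; decidable-stable)
open import Relation.Unary using (Decidable)
open import Relation.Binary.PropositionalEquality
  using (_≡_; _≢_; refl; sym; trans; cong; subst; module ≡-Reasoning)

open Equivalence using (to; from)

module _ {n : ℕ} where

  open BooleanAlgebraProperties (∪-∩-booleanAlgebra n)
    using () renaming (¬-involutive to ∁-involutive; ¬⊥≈⊤ to ∁⊥≡⊤; ¬⊤≈⊥ to ∁⊤≡⊥; deMorgan₂ to ∁-∪)

  ≡⊥⇒Empty : {p : Subset n} → p ≡ ⊥ → Empty p
  ≡⊥⇒Empty refl (_ , x∈⊥) = ∉⊥ x∈⊥

  Nonempty⇔≢⊥ : {p : Subset n} → Nonempty p ⇔ p ≢ ⊥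
  Nonempty⇔≢⊥ {p} = mk⇔ (λ ne p≡⊥ → ≡⊥⇒Empty p≡⊥ ne) nonempty
    where
    nonempty : p ≢ ⊥ → Nonempty p
    nonempty p≢⊥ with nonempty? p
    ... | yes ne = ne
    ... | no e   = contradiction (Empty-unique e) p≢⊥

  ∁p≡q⇒p≡∁q : {p q : Subset n} → ∁ p ≡ q → p ≡ ∁ q
  ∁p≡q⇒p≡∁q {p} {q} ∁p≡q = begin
    p        ≡⟨ sym (∁-involutive p) ⟩
    ∁ (∁ p)  ≡⟨ cong ∁ ∁p≡q ⟩
    ∁ q      ∎
    where open ≡-Reasoning

  Nonempty[∁p]⇔p≢⊤ : {p : Subset n} → Nonempty (∁ p) ⇔ p ≢ ⊤
  Nonempty[∁p]⇔p≢⊤ = mk⇔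
    (λ ne p≡⊤ → to Nonempty⇔≢⊥ ne (trans (cong ∁ p≡⊤) ∁⊤≡⊥))
    (λ p≢⊤ → from Nonempty⇔≢⊥ (λ ∁p≡⊥ → p≢⊤ (trans (∁p≡q⇒p≡∁q ∁p≡⊥) ∁⊥≡⊤)))

  Nonempty[∁p∩∁q]⇔p∪q≢⊤ : (p q : Subset n) → Nonempty (∁ p ∩ ∁ q) ⇔ p ∪ q ≢ ⊤
  Nonempty[∁p∩∁q]⇔p∪q≢⊤ p q =
    subst (λ r → Nonempty r ⇔ p ∪ q ≢ ⊤) (∁-∪ p q) Nonempty[∁p]⇔p≢⊤

  Nonempty[p∩∁q]⇔p⊈q : (p q : Subset n) → Nonempty (p ∩ ∁ q) ⇔ (¬ p ⊆ q)
  Nonempty[p∩∁q]⇔p⊈q p q = mk⇔ p∩∁q⇒p⊈q p⊈q⇒p∩∁q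
    where
    p∩∁q⇒p⊈q : Nonempty (p ∩ ∁ q) → ¬ p ⊆ q
    p∩∁q⇒p⊈q (x , x∈p∩∁q) p⊆q =
      let x∈p , x∈∁q = x∈p∩q⁻ p (∁ q) x∈p∩∁q in x∈∁p⇒x∉p x∈∁q (p⊆q x∈p)

    p⊈q⇒p∩∁q : ¬ p ⊆ q → Nonempty (p ∩ ∁ q)
    p⊈q⇒p∩∁q p⊈q with nonempty? (p ∩ ∁ q)
    ... | yes ne = ne
    ... | no e   = contradiction
      (λ {x} x∈p → x∉∁p⇒x∈p (λ x∈∁q → e (x , x∈p∩q⁺ (x∈p , x∈∁q)))) p⊈q

  Empty[∁p∩p] : (p : Subset n) → Empty (∁ p ∩ p)
  Empty[∁p∩p] p = ≡⊥⇒Empty (∩-inverseˡ p)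

  ∁-InP : {p : Subset n} → InP p → InP (∁ p)
  ∁-InP {p} (ne , p≢⊤) =
    from Nonempty[∁p]⇔p≢⊤ p≢⊤ ,
    to Nonempty[∁p]⇔p≢⊤ (subst Nonempty (sym (∁-involutive p)) ne)

module _ {n : ℕ} {𝒟 : SFam (suc n)} where

  switch⊆P : 𝒟 ⊆F InP → switch 𝒟 ⊆F InP
  switch⊆P _    _ (inj₁ ((X∈𝒫 , _) , _)) = X∈𝒫
  switch⊆P 𝒟⊆𝒫 _ (inj₂ (D , D∈𝒟 , refl)) = ∁-InP (𝒟⊆𝒫 D D∈𝒟)

  switch-maximal : Decidable 𝒟 →
    ∀ Y → InP Y → ¬ switch 𝒟 Y → ∃[ B ] (switch 𝒟 B × Empty (B ∩ Y))
  switch-maximal 𝒟? Y Y∈𝒫 Y∉𝒮 with zero ∈? Y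
  ... | yes 1∈Y = ∁ Y , inj₂ (Y , Y∈𝒟 , refl) , Empty[∁p∩p] Y
    where
    Y∈𝒟 : 𝒟 Y
    Y∈𝒟 = decidable-stable (𝒟? Y) (λ Y∉𝒟 → Y∉𝒮 (inj₁ ((Y∈𝒫 , 1∈Y) , Y∉𝒟)))
  ... | no 1∉Y = ∁ Y , inj₁ ((∁-InP Y∈𝒫 , x∉p⇒x∈∁p 1∉Y) , ∁Y∉𝒟) , Empty[∁p∩p] Y
    where
    ∁Y∉𝒟 : ¬ 𝒟 (∁ Y)
    ∁Y∉𝒟 ∁Y∈𝒟 = Y∉𝒮 (inj₂ (∁ Y , ∁Y∈𝒟 , ∁p≡q⇒p≡∁q refl))

  switch-maximalIntersecting⇔intersecting : 𝒟 ⊆F InP → Decidable 𝒟 →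
    MaximalIntersecting (switch 𝒟) ⇔ Intersecting (switch 𝒟)
  switch-maximalIntersecting⇔intersecting 𝒟⊆𝒫 𝒟? =
    mk⇔ (λ (_ , int , _) → int) (λ int → switch⊆P 𝒟⊆𝒫 , int , switch-maximal 𝒟?)

  intersecting⇒UDownSet : Decidable 𝒟 → Intersecting (switch 𝒟) → UDownSet 𝒟
  intersecting⇒UDownSet 𝒟? int D D′ D∈𝒟 D′⊆D D′∈𝒰 =
    decidable-stable (𝒟? D′) λ D′∉𝒟 →
      to (Nonempty[p∩∁q]⇔p⊈q D′ D)
        (int D′ (∁ D) (inj₁ (D′∈𝒰 , D′∉𝒟)) (inj₂ (D , D∈𝒟 , refl)))
        D′⊆D

  intersecting⇒NonCovering : Intersecting (switch 𝒟) → NonCovering 𝒟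
  intersecting⇒NonCovering int D₁ D₂ D₁∈𝒟 D₂∈𝒟 =
    to (Nonempty[∁p∩∁q]⇔p∪q≢⊤ D₁ D₂)
      (int (∁ D₁) (∁ D₂) (inj₂ (D₁ , D₁∈𝒟 , refl)) (inj₂ (D₂ , D₂∈𝒟 , refl)))

  UDownSet×NonCovering⇒intersecting :
    UDownSet 𝒟 → NonCovering 𝒟 → Intersecting (switch 𝒟)
  UDownSet×NonCovering⇒intersecting down nc = int
    where
    meets-∁ : ∀ {A D} → InU A → ¬ 𝒟 A → 𝒟 D → Nonempty (A ∩ ∁ D)
    meets-∁ {A} {D} A∈𝒰 A∉𝒟 D∈𝒟 =
      from (Nonempty[p∩∁q]⇔p⊈q A D) (λ A⊆D → A∉𝒟 (down D A D∈𝒟 A⊆D A∈𝒰))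

    int : Intersecting (switch 𝒟)
    int _ _ (inj₁ ((_ , 1∈A) , _)) (inj₁ ((_ , 1∈B) , _)) = zero , x∈p∩q⁺ (1∈A , 1∈B)
    int _ _ (inj₁ (A∈𝒰 , A∉𝒟)) (inj₂ (D , D∈𝒟 , refl)) = meets-∁ A∈𝒰 A∉𝒟 D∈𝒟
    int _ B (inj₂ (D , D∈𝒟 , refl)) (inj₁ (B∈𝒰 , B∉𝒟)) =
      subst Nonempty (∩-comm B (∁ D)) (meets-∁ B∈𝒰 B∉𝒟 D∈𝒟)
    int _ _ (inj₂ (D₁ , D₁∈𝒟 , refl)) (inj₂ (D₂ , D₂∈𝒟 , refl)) =
      from (Nonempty[∁p∩∁q]⇔p∪q≢⊤ D₁ D₂) (nc D₁ D₂ D₁∈𝒟 D₂∈𝒟)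

  switch-intersecting⇔UDownSet×NonCovering : Decidable 𝒟 →
    Intersecting (switch 𝒟) ⇔ (UDownSet 𝒟 × NonCovering 𝒟)
  switch-intersecting⇔UDownSet×NonCovering 𝒟? = mk⇔
    (λ int → intersecting⇒UDownSet 𝒟? int , intersecting⇒NonCovering int)
    (λ (down , nc) → UDownSet×NonCovering⇒intersecting down nc)

lemma2p5 : (n : ℕ) (ℬ 𝒟 : Family (suc n)) →
    MaximalIntersecting (mem ℬ) →
    mem 𝒟 ⊆F InU →
    MaximalIntersecting (switch (mem 𝒟)) ⇔ (UDownSet (mem 𝒟) × NonCovering (mem 𝒟))
lemma2p5 n ℬ 𝒟 _ 𝒟⊆𝒰 = ⇔-trans
  (switch-maximalIntersecting⇔intersecting (λ D D∈𝒟 → proj₁ (𝒟⊆𝒰 D D∈𝒟)) 𝒟?)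
  (switch-intersecting⇔UDownSet×NonCovering 𝒟?)
  where
  𝒟? : Decidable (mem 𝒟)
  𝒟? X = T? (𝒟 X)
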